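{- Let $n\ge 3$ be odd and let $D\subseteq\{0,1,\dots,n-1\}$ with $|D|=2$. Then the unidirectional cycle $\overrightarrow{C_n}$ is $D$-antimagic.
   Context: The unidirectional cycle $\overrightarrow{C_n}$ has vertices $v_1,\dots,v_n$ and arcs $(v_i,v_{i+1})$ for $1\le i\le n-1$ and $(v_n,v_1)$; thus $d(v_i,v_j)=(j-i)\bmod n$, where $d(u,y)$ is the length of a shortest directed path from $u$ to $y$. $N_D(v)=\{y: d(v,y)\in D\}$; a bijection $f:V\to\{1,\dots,n\}$ is $D$-antimagic if $\omega_D(v)=\sum_{y\in N_D(v)}f(y)$ are pairwise distinct; the graph is $D$-antimagic if such a bijection exists. -}

module Defs where

open import Data.Nat using (ℕ; suc; _+_; _∸_; _%_; NonZero)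
open import Data.Fin using (Fin; toℕ; fromℕ<)
open import Data.Fin.Subset using (Subset; _∈_)
open import Data.Fin.Subset.Properties using (_∈?_)
open import Data.List using (List; map; filter; allFin)
open import Data.Nat.ListAction using (sum)
open import Data.Nat.DivMod using (m%n<n)
open import Data.Product using (Σ)
open import Function.Bundles using (_⤖_; Bijection)
open import Relation.Binary.PropositionalEquality using (_≡_)
open import Relation.Nullary using (¬_)

-- Vertices of the unidirectional cycle C⃗ₙ are Fin n; vertex i : Fin n is v_{i+1}.
-- Arcs are i → i+1 (mod n).  Directed distance d(u,y) = (y − u) mod n.
dist : (n : ℕ) → .{{_ : NonZero n}} → Fin n → Fin n → Fin n
dist n u y = fromℕ< (m%n<n (toℕ y + (n ∸ toℕ u)) n)

N : (n : ℕ) → .{{_ : NonZero n}} → Subset n → Fin n → List (Fin n)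
N n D v = filter (λ y → dist n v y ∈? D) (allFin n)

-- A labelling f : V → {1,…,n} is encoded as a bijection f : Fin n ⤖ Fin n,
-- vertex y receiving label toℕ (f y) + 1.
label : {n : ℕ} → Fin n ⤖ Fin n → Fin n → ℕ
label f y = suc (toℕ (Bijection.to f y))

weight : (n : ℕ) → .{{_ : NonZero n}} → Subset n → Fin n ⤖ Fin n → Fin n → ℕ
weight n D f v = sum (map (label f) (N n D v))

IsDAntimagic : (n : ℕ) → .{{_ : NonZero n}} → Subset n → Fin n ⤖ Fin n → Set
IsDAntimagic n D f = ∀ u v → ¬ (u ≡ v) → ¬ (weight n D f u ≡ weight n D f v)

DAntimagicCycle : (n : ℕ) → .{{_ : NonZero n}} → Subset n → Set
DAntimagicCycle n D = Σ (Fin n ⤖ Fin n) (IsDAntimagic n D)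

-- The identity labelling works.  With it, the D-neighbours of v = {a, b} are v + a and
-- v + b (mod n), so ω(v) − 2 = (v + a) mod n + (v + b) mod n ≡ 2v + a + b (mod n).
-- Equal weights therefore give 2u ≡ 2v (mod n), and doubling is injective modulo an
-- odd n: 2u and 2v lie in [0, 2n), so they can only differ by n, which is odd.
module Submission where

open import Defs
open import Data.Nat using (ℕ; _≤_; _%_; NonZero)
open import Data.Fin.Subset using (Subset; ∣_∣)
open import Relation.Binary.PropositionalEquality using (_≡_)

open import Data.Bool using (true; false; if_then_else_)
open import Data.Empty using (⊥-elim)
open import Data.Fin using (Fin; zero; suc; toℕ; fromℕ<; punchIn)
open import Data.Fin.Properties using (_≟_; suc-injective; toℕ-fromℕ<; toℕ<n; toℕ-injective; punchInᵢ≢i)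
open import Data.Fin.Subset using (_∈_; _∉_; inside; outside)
open import Data.Fin.Subset.Properties using (_∈?_)
open import Data.List using (map; filter; tabulate; allFin)
open import Data.Nat using (suc; pred; _+_; _*_; _∸_; _/_; _<_; s≤s)
open import Data.Nat.DivMod
open import Data.Nat.Divisibility using (m∣m*n)
open import Data.Nat.ListAction using (sum)
open import Data.Nat.Properties hiding (_≟_; suc-injective)
open import Algebra.Properties.CommutativeMonoid.Sum +-0-commutativeMonoid
  using (sum-remove; ∑-distrib-+; sum-cong-≗; sum-replicate-zero)
  renaming (sum to ∑)
open import Data.Nat.Tactic.RingSolver using (solve-∀)
open import Data.Product using (∃-syntax; _×_; _,_)
open import Data.Sum using (_⊎_; inj₁; inj₂; [_,_])
import Data.Sum as Sum
open import Data.Vec using (_∷_; here; there)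
open import Function using (_∘_; id)
open import Function.Construct.Identity using (⤖-id)
open import Level using (0ℓ)
open import Relation.Binary.PropositionalEquality
  using (_≢_; _≗_; refl; sym; trans; cong; cong₂; subst; module ≡-Reasoning)
open import Relation.Nullary using (does; yes; no; contradiction)
open import Relation.Nullary.Decidable using (dec-true)
open import Relation.Unary using (Pred; Decidable)

private variable
  A B : Set
  n : ℕ

IsPair : Pred A 0ℓ → A → A → Set
IsPair P x y = x ≢ y × P x × P y × (∀ z → P z → z ≡ x ⊎ z ≡ y)

IsPair-preimage : (f : B → A) (g : A → B) → (∀ x → f (g x) ≡ x) → (∀ z → g (f z) ≡ z) →
                  {P : Pred A 0ℓ} {x y : A} → IsPair P x y → IsPair (P ∘ f) (g x) (g y)
IsPair-preimage f g fg gf {P} (x≢y , Px , Py , onlyxy) =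
    (λ gx≡gy → x≢y (trans (sym (fg _)) (trans (cong f gx≡gy) (fg _))))
  , subst P (sym (fg _)) Px
  , subst P (sym (fg _)) Py
  , λ z Pfz → Sum.map (λ fz≡x → trans (sym (gf z)) (cong g fz≡x))
                      (λ fz≡y → trans (sym (gf z)) (cong g fz≡y)) (onlyxy (f z) Pfz)

∣p∣≡0⇒x∉p : (p : Subset n) → ∣ p ∣ ≡ 0 → ∀ x → x ∉ p
∣p∣≡0⇒x∉p (outside ∷ p) ∣p∣≡0 (suc x) (there x∈p) = ∣p∣≡0⇒x∉p p ∣p∣≡0 x x∈p

∣p∣≡1⇒singleton : (p : Subset n) → ∣ p ∣ ≡ 1 → ∃[ x ] (x ∈ p × ∀ z → z ∈ p → z ≡ x)
∣p∣≡1⇒singleton (inside ∷ p) ∣p∣≡1 =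
  zero , here , λ { zero _ → refl ; (suc z) (there z∈p) → ⊥-elim (∣p∣≡0⇒x∉p p (cong pred ∣p∣≡1) z z∈p) }
∣p∣≡1⇒singleton (outside ∷ p) ∣p∣≡1 with ∣p∣≡1⇒singleton p ∣p∣≡1
... | x , x∈p , onlyx = suc x , there x∈p , λ { (suc z) (there z∈p) → cong suc (onlyx z z∈p) }

∣p∣≡2⇒IsPair : (p : Subset n) → ∣ p ∣ ≡ 2 → ∃[ x ] ∃[ y ] IsPair (_∈ p) x y
∣p∣≡2⇒IsPair (inside ∷ p) ∣p∣≡2 with ∣p∣≡1⇒singleton p (cong pred ∣p∣≡2)
... | y , y∈p , onlyy =
  zero , suc y , (λ ()) , here , there y∈p ,
  λ { zero _ → inj₁ refl ; (suc z) (there z∈p) → inj₂ (cong suc (onlyy z z∈p)) }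
∣p∣≡2⇒IsPair (outside ∷ p) ∣p∣≡2 with ∣p∣≡2⇒IsPair p ∣p∣≡2
... | x , y , x≢y , x∈p , y∈p , onlyxy =
  suc x , suc y , x≢y ∘ suc-injective , there x∈p , there y∈p ,
  λ { (suc z) (there z∈p) → Sum.map (cong suc) (cong suc) (onlyxy z z∈p) }

mask : {P : Pred A 0ℓ} → Decidable P → (A → ℕ) → A → ℕ
mask P? h x = if does (P? x) then h x else 0

sum-filter-tabulate : {P : Pred A 0ℓ} (P? : Decidable P) (h : A → ℕ) (f : Fin n → A) →
                      sum (map h (filter P? (tabulate f))) ≡ ∑ (mask P? h ∘ f)
sum-filter-tabulate {n = ℕ.zero} P? h f = refl
sum-filter-tabulate {n = suc n}  P? h f with does (P? (f zero))
... | true  = cong (h (f zero) +_) (sum-filter-tabulate P? h (f ∘ suc))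
... | false = sum-filter-tabulate P? h (f ∘ suc)

δ : Fin n → ℕ → Fin n → ℕ
δ p c i = if does (i ≟ p) then c else 0

∑-δ : (p : Fin n) (c : ℕ) → ∑ (δ p c) ≡ c
∑-δ {n = suc n} p c = begin
  ∑ (δ p c)                              ≡⟨ sum-remove {i = p} (δ p c) ⟩
  δ p c p + ∑ (δ p c ∘ punchIn p)        ≡⟨ cong₂ _+_ δ-at-p (sum-cong-≗ δ-off-p) ⟩
  c + ∑ {n} (λ _ → 0)                    ≡⟨ cong (c +_) (sum-replicate-zero n) ⟩
  c + 0                                  ≡⟨ +-identityʳ c ⟩
  c                                      ∎
  where
  open ≡-Reasoning
  δ-at-p : δ p c p ≡ c
  δ-at-p rewrite dec-true (p ≟ p) refl = refl
  δ-off-p : δ p c ∘ punchIn p ≗ λ _ → 0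
  δ-off-p j with punchIn p j ≟ p
  ... | yes pᵢ≡p = contradiction pᵢ≡p (punchInᵢ≢i p j)
  ... | no _     = refl

mask-IsPair : {P : Pred (Fin n) 0ℓ} (P? : Decidable P) (h : Fin n → ℕ) {p q : Fin n} →
              IsPair P p q → mask P? h ≗ λ i → δ p (h p) i + δ q (h q) i
mask-IsPair P? h {p} {q} (p≢q , Pp , Pq , onlypq) i with P? i | i ≟ p | i ≟ q
... | yes _  | yes refl | yes refl = contradiction refl p≢q
... | yes _  | yes refl | no _     = sym (+-identityʳ _)
... | yes _  | no _     | yes refl = refl
... | yes Pi | no i≢p   | no i≢q   = contradiction (onlypq i Pi) [ i≢p , i≢q ]
... | no ¬Pi | yes refl | _        = contradiction Pp ¬Pi
... | no ¬Pi | no _     | yes refl = contradiction Pq ¬Pi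
... | no _   | no _     | no _     = refl

sum-filter-IsPair : {P : Pred (Fin n) 0ℓ} (P? : Decidable P) (h : Fin n → ℕ) {p q : Fin n} →
                    IsPair P p q → sum (map h (filter P? (allFin n))) ≡ h p + h q
sum-filter-IsPair P? h {p} {q} pair = begin
  sum (map h (filter P? (allFin _)))         ≡⟨ sum-filter-tabulate P? h id ⟩
  ∑ (mask P? h)                              ≡⟨ sum-cong-≗ (mask-IsPair P? h pair) ⟩
  ∑ (λ i → δ p (h p) i + δ q (h q) i)        ≡⟨ ∑-distrib-+ (δ p (h p)) (δ q (h q)) ⟩
  ∑ (δ p (h p)) + ∑ (δ q (h q))              ≡⟨ cong₂ _+_ (∑-δ p (h p)) (∑-δ q (h q)) ⟩
  h p + h q                                  ∎
  where open ≡-Reasoning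

[m%n+k]%n≡[m+k]%n : ∀ m k n .{{_ : NonZero n}} → (m % n + k) % n ≡ (m + k) % n
[m%n+k]%n≡[m+k]%n m k n = begin
  (m % n + k) % n          ≡⟨ %-distribˡ-+ (m % n) k n ⟩
  (m % n % n + k % n) % n  ≡⟨ cong (λ x → (x + k % n) % n) (m%n%n≡m%n m n) ⟩
  (m % n + k % n) % n      ≡⟨ %-distribˡ-+ m k n ⟨
  (m + k) % n              ∎
  where open ≡-Reasoning

[m+k%n]%n≡[m+k]%n : ∀ m k n .{{_ : NonZero n}} → (m + k % n) % n ≡ (m + k) % n
[m+k%n]%n≡[m+k]%n m k n = begin
  (m + k % n) % n  ≡⟨ cong (_% n) (+-comm m (k % n)) ⟩
  (k % n + m) % n  ≡⟨ [m%n+k]%n≡[m+k]%n k m n ⟩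
  (k + m) % n      ≡⟨ cong (_% n) (+-comm k m) ⟩
  (m + k) % n      ∎
  where open ≡-Reasoning

-- Adding c * n ∸ c undoes adding c modulo n, without any subtraction going below zero.
%-cancelʳ-+ : ∀ c {m k} n .{{_ : NonZero n}} → (m + c) % n ≡ (k + c) % n → m % n ≡ k % n
%-cancelʳ-+ c {m} {k} n eq = begin
  m % n                               ≡⟨ undo-c m ⟩
  ((m + c) % n + (c * n ∸ c)) % n     ≡⟨ cong (λ x → (x + (c * n ∸ c)) % n) eq ⟩
  ((k + c) % n + (c * n ∸ c)) % n     ≡⟨ undo-c k ⟨
  k % n                               ∎
  where
  open ≡-Reasoning
  undo-c : ∀ x → x % n ≡ ((x + c) % n + (c * n ∸ c)) % n
  undo-c x = begin
    x % n                             ≡⟨ [m+kn]%n≡m%n x c n ⟨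
    (x + c * n) % n                   ≡⟨ cong (λ y → (x + y) % n) (m+[n∸m]≡n (m≤m*n c n)) ⟨
    (x + (c + (c * n ∸ c))) % n       ≡⟨ cong (_% n) (+-assoc x c _) ⟨
    (x + c + (c * n ∸ c)) % n         ≡⟨ [m%n+k]%n≡[m+k]%n (x + c) _ n ⟨
    ((x + c) % n + (c * n ∸ c)) % n   ∎

m<2n⇒m≡m%n⊎m≡m%n+n : ∀ m n .{{_ : NonZero n}} → m < 2 * n → m ≡ m % n ⊎ m ≡ m % n + n
m<2n⇒m≡m%n⊎m≡m%n+n m n m<2n with m / n | m≡m%n+[m/n]*n m n | m<n*o⇒m/o<n {m} {2} {n} m<2n
... | 0           | m≡ | _ = inj₁ (trans m≡ (+-identityʳ _))
... | 1           | m≡ | _ = inj₂ (trans m≡ (cong (m % n +_) (+-identityʳ n)))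
... | suc (suc _) | _  | s≤s (s≤s ())

even+odd≢even : ∀ {n} u v → n % 2 ≡ 1 → 2 * u + n ≢ 2 * v
even+odd≢even {n} u v n-odd eq = contradiction (begin
  1                ≡⟨ n-odd ⟨
  n % 2            ≡⟨ %-remove-+ˡ n (m∣m*n u) ⟨
  (2 * u + n) % 2  ≡⟨ cong (_% 2) eq ⟩
  (2 * v) % 2      ≡⟨ cong (_% 2) (*-comm 2 v) ⟩
  (v * 2) % 2      ≡⟨ m*n%n≡0 v 2 ⟩
  0                ∎) λ ()
  where open ≡-Reasoning

2*-injective-mod-odd : ∀ {u v} n .{{_ : NonZero n}} → n % 2 ≡ 1 → u < n → v < n →
                       (2 * u) % n ≡ (2 * v) % n → u ≡ v
2*-injective-mod-odd {u} {v} n n-odd u<n v<n eq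
  with m<2n⇒m≡m%n⊎m≡m%n+n (2 * u) n (*-monoʳ-< 2 u<n)
     | m<2n⇒m≡m%n⊎m≡m%n+n (2 * v) n (*-monoʳ-< 2 v<n)
... | inj₁ 2u≡ | inj₁ 2v≡ = *-cancelˡ-≡ u v 2 (trans 2u≡ (trans eq (sym 2v≡)))
... | inj₂ 2u≡ | inj₂ 2v≡ = *-cancelˡ-≡ u v 2 (trans 2u≡ (trans (cong (_+ n) eq) (sym 2v≡)))
... | inj₁ 2u≡ | inj₂ 2v≡ = contradiction (trans (cong (_+ n) (trans 2u≡ eq)) (sym 2v≡)) (even+odd≢even u v n-odd)
... | inj₂ 2u≡ | inj₁ 2v≡ = contradiction (trans (cong (_+ n) (trans 2v≡ (sym eq))) (sym 2u≡)) (even+odd≢even v u n-odd)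

module _ {n : ℕ} .{{_ : NonZero n}} where

  infixl 6 _⊕_
  _⊕_ : Fin n → Fin n → Fin n
  v ⊕ a = fromℕ< (m%n<n (toℕ v + toℕ a) n)

  toℕ-⊕ : ∀ v a → toℕ (v ⊕ a) ≡ (toℕ v + toℕ a) % n
  toℕ-⊕ v a = toℕ-fromℕ< _

  toℕ-dist : ∀ v y → toℕ (dist n v y) ≡ (toℕ y + (n ∸ toℕ v)) % n
  toℕ-dist v y = toℕ-fromℕ< _

  private
    v+[n∸v]≡n : ∀ (v : Fin n) → toℕ v + (n ∸ toℕ v) ≡ n
    v+[n∸v]≡n v = m+[n∸m]≡n (<⇒≤ (toℕ<n v))

    [x+n]%n≡x : ∀ (x : Fin n) → (toℕ x + n) % n ≡ toℕ x
    [x+n]%n≡x x = trans ([m+n]%n≡m%n (toℕ x) n) (m<n⇒m%n≡m (toℕ<n x))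

  dist-⊕ : ∀ v a → dist n v (v ⊕ a) ≡ a
  dist-⊕ v a = toℕ-injective (begin
    toℕ (dist n v (v ⊕ a))                   ≡⟨ toℕ-dist v (v ⊕ a) ⟩
    (toℕ (v ⊕ a) + (n ∸ toℕ v)) % n          ≡⟨ cong (λ x → (x + (n ∸ toℕ v)) % n) (toℕ-⊕ v a) ⟩
    ((toℕ v + toℕ a) % n + (n ∸ toℕ v)) % n  ≡⟨ [m%n+k]%n≡[m+k]%n (toℕ v + toℕ a) _ n ⟩
    (toℕ v + toℕ a + (n ∸ toℕ v)) % n        ≡⟨ cong (_% n) (swap (toℕ v) (toℕ a) (n ∸ toℕ v)) ⟩
    (toℕ a + (toℕ v + (n ∸ toℕ v))) % n      ≡⟨ cong (λ x → (toℕ a + x) % n) (v+[n∸v]≡n v) ⟩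
    (toℕ a + n) % n                          ≡⟨ [x+n]%n≡x a ⟩
    toℕ a                                    ∎)
    where
    open ≡-Reasoning
    swap : ∀ x y z → x + y + z ≡ y + (x + z)
    swap = solve-∀

  ⊕-dist : ∀ v y → v ⊕ dist n v y ≡ y
  ⊕-dist v y = toℕ-injective (begin
    toℕ (v ⊕ dist n v y)                     ≡⟨ toℕ-⊕ v (dist n v y) ⟩
    (toℕ v + toℕ (dist n v y)) % n           ≡⟨ cong (λ x → (toℕ v + x) % n) (toℕ-dist v y) ⟩
    (toℕ v + (toℕ y + (n ∸ toℕ v)) % n) % n  ≡⟨ [m+k%n]%n≡[m+k]%n (toℕ v) _ n ⟩
    (toℕ v + (toℕ y + (n ∸ toℕ v))) % n      ≡⟨ cong (_% n) (swap (toℕ v) (toℕ y) (n ∸ toℕ v)) ⟩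
    (toℕ y + (toℕ v + (n ∸ toℕ v))) % n      ≡⟨ cong (λ x → (toℕ y + x) % n) (v+[n∸v]≡n v) ⟩
    (toℕ y + n) % n                          ≡⟨ [x+n]%n≡x y ⟩
    toℕ y                                    ∎)
    where
    open ≡-Reasoning
    swap : ∀ x y z → x + (y + z) ≡ y + (x + z)
    swap = solve-∀

  weight-id : {D : Subset n} {a b : Fin n} → IsPair (_∈ D) a b →
              ∀ v → weight n D (⤖-id (Fin n)) v ≡ 2 + (toℕ (v ⊕ a) + toℕ (v ⊕ b))
  weight-id {D} {a} {b} pair v = begin
    weight n D (⤖-id (Fin n)) v            ≡⟨ sum-filter-IsPair (λ y → dist n v y ∈? D) (suc ∘ toℕ) neighbours ⟩
    suc (toℕ (v ⊕ a)) + suc (toℕ (v ⊕ b))  ≡⟨ cong suc (+-suc _ _) ⟩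
    2 + (toℕ (v ⊕ a) + toℕ (v ⊕ b))        ∎
    where
    open ≡-Reasoning
    neighbours : IsPair (λ y → dist n v y ∈ D) (v ⊕ a) (v ⊕ b)
    neighbours = IsPair-preimage (dist n v) (v ⊕_) (dist-⊕ v) (⊕-dist v) pair

  ⊕-pair-sum-mod : ∀ v a b → (toℕ (v ⊕ a) + toℕ (v ⊕ b)) % n ≡ (2 * toℕ v + (toℕ a + toℕ b)) % n
  ⊕-pair-sum-mod v a b = begin
    (toℕ (v ⊕ a) + toℕ (v ⊕ b)) % n                  ≡⟨ cong₂ (λ x y → (x + y) % n) (toℕ-⊕ v a) (toℕ-⊕ v b) ⟩
    ((toℕ v + toℕ a) % n + (toℕ v + toℕ b) % n) % n  ≡⟨ %-distribˡ-+ (toℕ v + toℕ a) _ n ⟨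
    (toℕ v + toℕ a + (toℕ v + toℕ b)) % n            ≡⟨ cong (_% n) (regroup (toℕ v) (toℕ a) (toℕ b)) ⟩
    (2 * toℕ v + (toℕ a + toℕ b)) % n                ∎
    where
    open ≡-Reasoning
    regroup : ∀ x y z → x + y + (x + z) ≡ 2 * x + (y + z)
    regroup = solve-∀

  ⊕-pair-sum-injective : n % 2 ≡ 1 → ∀ a b {u v} →
                         toℕ (u ⊕ a) + toℕ (u ⊕ b) ≡ toℕ (v ⊕ a) + toℕ (v ⊕ b) → u ≡ v
  ⊕-pair-sum-injective n-odd a b {u} {v} eq =
    toℕ-injective (2*-injective-mod-odd n n-odd (toℕ<n u) (toℕ<n v) (%-cancelʳ-+ (toℕ a + toℕ b) n (begin
      (2 * toℕ u + (toℕ a + toℕ b)) % n  ≡⟨ ⊕-pair-sum-mod u a b ⟨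
      (toℕ (u ⊕ a) + toℕ (u ⊕ b)) % n    ≡⟨ cong (_% n) eq ⟩
      (toℕ (v ⊕ a) + toℕ (v ⊕ b)) % n    ≡⟨ ⊕-pair-sum-mod v a b ⟩
      (2 * toℕ v + (toℕ a + toℕ b)) % n  ∎)))
    where open ≡-Reasoning

mainTheorem4 : (n : ℕ) → .{{_ : NonZero n}} → 3 ≤ n → n % 2 ≡ 1 →
               (D : Subset n) → ∣ D ∣ ≡ 2 → DAntimagicCycle n D
mainTheorem4 n _ n-odd D ∣D∣≡2 with ∣p∣≡2⇒IsPair D ∣D∣≡2
... | a , b , pair = ⤖-id (Fin n) , λ u v u≢v ωu≡ωv →
  u≢v (⊕-pair-sum-injective n-odd a b
        (+-cancelˡ-≡ 2 _ _ (trans (sym (weight-id pair u)) (trans ωu≡ωv (weight-id pair v)))))
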